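{- Let \(\mathcal V\) be a universe, let \((X,\sqsubseteq)\) be a \(\mathcal V\)-sup-lattice with least element \(\bot\), and let \(y:X\). The following are equivalent: (i) \(\bot\) is strictly below \(y\); (ii) for every family \(\alpha:I\to X\) with \(I:\mathcal V\) and \(y\sqsubseteq\bigvee\alpha\), there exists some element of \(I\) (i.e. \(\|I\|\)); (iii) there exists \(x:X\) such that \(x\) is strictly below \(y\).
   Context: Setting: intensional Martin-Löf type theory with universes, function extensionality, propositional extensionality, propositional truncation \(\|\cdot\|\); "there exists" means truncated existence. A poset is a type with a proposition-valued reflexive, transitive, antisymmetric relation \(\sqsubseteq\). A \(\mathcal V\)-sup-lattice is a poset in which every family \(\alpha:I\to X\) with \(I:\mathcal V\) has a supremum \(\bigvee\alpha\). For \(x\sqsubseteq y\) and a proposition \(P:\mathcal V\), \(\delta_{x,y,P}:\mathbf 1+P\to X\) sends \(\mathrm{inl}(\star)\mapsto x\), \(\mathrm{inr}(p)\mapsto y\). \(x\) is strictly below \(y\) if \(x\sqsubseteq y\) and for every \(z\) with \(y\sqsubseteq z\) and every proposition \(P:\mathcal V\), \(z=\bigvee\delta_{x,z,P}\) implies \(P\). -}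

module Defs where

open import Level using (Level; _⊔_; suc)
open import Agda.Primitive using (Setω)
open import Data.Product using (Σ; _×_)
open import Data.Sum using (_⊎_; inj₁; inj₂)
open import Data.Unit.Polymorphic using (⊤)
open import Relation.Binary.PropositionalEquality using (_≡_)

is-prop : ∀ {ℓ} → Set ℓ → Set ℓ
is-prop A = (a b : A) → a ≡ b

-- Propositional truncation, given as an assumed (universe-polymorphic)
-- structure, since --safe Agda without cubical has no HITs.
record PropTrunc : Setω where
  field
    ∥_∥       : ∀ {ℓ} → Set ℓ → Set ℓ
    ∣_∣       : ∀ {ℓ} {A : Set ℓ} → A → ∥ A ∥
    ∥∥-is-prop : ∀ {ℓ} {A : Set ℓ} → is-prop ∥ A ∥
    ∥∥-rec    : ∀ {ℓ ℓ'} {A : Set ℓ} {B : Set ℓ'} → is-prop B → (A → B) → ∥ A ∥ → B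

-- A 𝓥-sup-lattice: a poset (carrier in Set u, relation valued in Set w,
-- proposition-valued) with suprema of all families indexed by I : Set v.
record SupLattice (u w v : Level) : Set (suc (u ⊔ w ⊔ v)) where
  field
    Carrier    : Set u
    _⊑_        : Carrier → Carrier → Set w
    ⊑-is-prop  : ∀ x y → is-prop (x ⊑ y)
    ⊑-refl     : ∀ x → x ⊑ x
    ⊑-trans    : ∀ x y z → x ⊑ y → y ⊑ z → x ⊑ z
    ⊑-antisym  : ∀ x y → x ⊑ y → y ⊑ x → x ≡ y
    ⋁          : {I : Set v} → (I → Carrier) → Carrier
    ⋁-is-upperbound : {I : Set v} (α : I → Carrier) (i : I) → α i ⊑ ⋁ α
    ⋁-is-lowerbound-of-upperbounds : {I : Set v} (α : I → Carrier) (x : Carrier)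
                                   → ((i : I) → α i ⊑ x) → ⋁ α ⊑ x

module _ {u w v : Level} (L : SupLattice u w v) where
  open SupLattice L

  is-least : Carrier → Set (u ⊔ w)
  is-least b = (x : Carrier) → b ⊑ x

  δ : Carrier → Carrier → (P : Set v) → ⊤ {v} ⊎ P → Carrier
  δ x y P (inj₁ _) = x
  δ x y P (inj₂ _) = y

  is-strictly-below : Carrier → Carrier → Set (u ⊔ w ⊔ suc v)
  is-strictly-below x y =
    (x ⊑ y) ×
    ((z : Carrier) → y ⊑ z → (P : Set v) → is-prop P → z ≡ ⋁ (δ x z P) → P)

{-# OPTIONS --safe #-}
module Submission where

open import Level using (_⊔_; suc)
open import Defs
open import Data.Product using (Σ; _×_; _,_)
open import Data.Sum using (_⊎_; inj₁; inj₂)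
open import Data.Unit.Polymorphic using (⊤)
open import Function.Bundles using (_⇔_; mk⇔)
open import Relation.Binary.PropositionalEquality using (_≡_; subst)

-- A family α with x ⊑ ⋁ α has the same join as δ x (⋁ α) ∥ I ∥, because every α i is
-- reached through the right summand.  So any x strictly below y forces every α with
-- y ⊑ ⋁ α to be inhabited.  Conversely, if y is positive and z = ⋁ δ ⊥ z P, then
-- y ⊑ z is bounded by the join of the constant family P → z, so P is inhabited;
-- hence ⊥ is strictly below y, which is also the witness for (iii).

module Positivity {u w v} (pt : PropTrunc) (L : SupLattice u w v) where
  open PropTrunc pt
  open SupLattice L

  is-positive : Carrier → Set (u ⊔ w ⊔ suc v)
  is-positive y = (I : Set v) (α : I → Carrier) → y ⊑ ⋁ α → ∥ I ∥

  ⋁-δ-⊑ : ∀ x z (P : Set v) → x ⊑ z → ⋁ (δ L x z P) ⊑ z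
  ⋁-δ-⊑ x z P x⊑z = ⋁-is-lowerbound-of-upperbounds (δ L x z P) z λ
    { (inj₁ _) → x⊑z
    ; (inj₂ _) → ⊑-refl z }

  ⋁≡⋁-δ-inhabited : ∀ x {I : Set v} (α : I → Carrier)
                  → x ⊑ ⋁ α → ⋁ α ≡ ⋁ (δ L x (⋁ α) ∥ I ∥)
  ⋁≡⋁-δ-inhabited x {I} α x⊑⋁α =
    ⊑-antisym (⋁ α) (⋁ d) ⋁α⊑⋁d (⋁-δ-⊑ x (⋁ α) _ x⊑⋁α)
    where
    d : ⊤ ⊎ ∥ I ∥ → Carrier
    d = δ L x (⋁ α) ∥ I ∥
    ⋁α⊑⋁d : ⋁ α ⊑ ⋁ d
    ⋁α⊑⋁d = ⋁-is-lowerbound-of-upperbounds α (⋁ d) λ i →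
      ⊑-trans (α i) (⋁ α) (⋁ d) (⋁-is-upperbound α i) (⋁-is-upperbound d (inj₂ ∣ i ∣))

  ⋁-δ-⊑-⋁-const : ∀ ⊥ → is-least L ⊥ → ∀ z (P : Set v)
                → ⋁ (δ L ⊥ z P) ⊑ ⋁ {P} (λ _ → z)
  ⋁-δ-⊑-⋁-const ⊥ ⊥-least z P =
    ⋁-is-lowerbound-of-upperbounds (δ L ⊥ z P) (⋁ {P} (λ _ → z)) λ
      { (inj₁ _) → ⊥-least _
      ; (inj₂ p) → ⋁-is-upperbound (λ _ → z) p }

  strictly-below⇒positive : ∀ x y → is-strictly-below L x y → is-positive y
  strictly-below⇒positive x y (x⊑y , x≪y) I α y⊑⋁α =
    x≪y (⋁ α) y⊑⋁α ∥ I ∥ ∥∥-is-prop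
        (⋁≡⋁-δ-inhabited x α (⊑-trans x y (⋁ α) x⊑y y⊑⋁α))

  positive⇒⊥-strictly-below : ∀ ⊥ → is-least L ⊥ → ∀ y
                            → is-positive y → is-strictly-below L ⊥ y
  positive⇒⊥-strictly-below ⊥ ⊥-least y y-positive = ⊥-least y , ⊥≪y
    where
    ⊥≪y : ∀ z → y ⊑ z → (P : Set v) → is-prop P → z ≡ ⋁ (δ L ⊥ z P) → P
    ⊥≪y z y⊑z P P-is-prop z≡⋁δ =
      ∥∥-rec P-is-prop (λ p → p) (y-positive P (λ _ → z) y⊑⋁z)
      where
      y⊑⋁z : y ⊑ ⋁ {P} (λ _ → z)
      y⊑⋁z = ⊑-trans y (⋁ (δ L ⊥ z P)) _ (subst (y ⊑_) z≡⋁δ y⊑z)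
                     (⋁-δ-⊑-⋁-const ⊥ ⊥-least z P)

  ∃-strictly-below⇒positive : ∀ y → ∥ Σ Carrier (λ x → is-strictly-below L x y) ∥
                            → is-positive y
  ∃-strictly-below⇒positive y ∃x≪y I α y⊑⋁α =
    ∥∥-rec ∥∥-is-prop (λ (x , x≪y) → strictly-below⇒positive x y x≪y I α y⊑⋁α) ∃x≪y

proposition3p12 : ∀ {u w v} (pt : PropTrunc) (L : SupLattice u w v)
    → let open PropTrunc pt
          open SupLattice L
      in (⊥ : Carrier) → is-least L ⊥ → (y : Carrier)
    → (is-strictly-below L ⊥ y
         ⇔ ((I : Set v) (α : I → Carrier) → y ⊑ ⋁ α → ∥ I ∥))
      × (((I : Set v) (α : I → Carrier) → y ⊑ ⋁ α → ∥ I ∥)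
         ⇔ ∥ Σ Carrier (λ x → is-strictly-below L x y) ∥)
proposition3p12 pt L ⊥ ⊥-least y =
    mk⇔ (strictly-below⇒positive ⊥ y) ⊥≪y-of-positive
  , mk⇔ (λ y-positive → ∣ ⊥ , ⊥≪y-of-positive y-positive ∣) (∃-strictly-below⇒positive y)
  where
  open PropTrunc pt
  open Positivity pt L
  ⊥≪y-of-positive : is-positive y → is-strictly-below L ⊥ y
  ⊥≪y-of-positive = positive⇒⊥-strictly-below ⊥ ⊥-least y
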